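{- Let $\mathcal{A}=\{a,b\}$ be a set with $a\ne b$. The Rudin–Shapiro word on $\mathcal{A}$ satisfies property $\spadesuit$ with constant $c=25$.
   Context: The Rudin–Shapiro sequence on $\{a,b\}$ is $(a_n)_{n\ge0}$ with $a_n=a$ if the number of (possibly overlapping) occurrences of the block $11$ in the base-$2$ expansion of $n$ is even, and $a_n=b$ otherwise; the Rudin–Shapiro word is $a_0a_1a_2\cdots$. For a finite word $\omega$, $|\omega|$ is its length. An infinite word $\omega$ has property $\spadesuit$ with constant $c\ge0$ if $\omega$ is not ultimately periodic and there exist sequences $(U_n),(V_n),(W_n)$ of finite words such that for every $n\ge1$ the word $W_nU_nV_nU_n$ is a prefix of $\omega$, $\max(|V_n|/|U_n|,|W_n|/|U_n|)\le c$ for every $n\ge1$, and $(|U_n|)_n$ is unbounded. -}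

module Defs where

open import Data.Nat using (ℕ; zero; suc; _+_; _*_; _≤_; _<_)
open import Data.Nat.DivMod using (_/_; _%_)
open import Data.Bool using (Bool; true; false; if_then_else_; not)
open import Data.List using (List; []; _∷_; length; lookup; _++_)
open import Data.Fin using (Fin; toℕ)
open import Data.Product using (Σ; _×_; ∃-syntax)
open import Relation.Binary.PropositionalEquality using (_≡_)
open import Relation.Nullary using (¬_)

-- Base-2 digits of m, least significant first, using fuel k (k ≥ m suffices).
bitsAux : ℕ → ℕ → List Bool
bitsAux zero    _       = []
bitsAux (suc k) zero    = []
bitsAux (suc k) (suc m) = ((suc m % 2) Data.Nat.≡ᵇ 1) ∷ bitsAux k (suc m / 2)

binary : ℕ → List Bool
binary n = bitsAux n n

count11 : List Bool → ℕ
count11 []                    = 0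
count11 (_ ∷ [])              = 0
count11 (true  ∷ true ∷ rest) = suc (count11 (true ∷ rest))
count11 (_     ∷ d    ∷ rest) = count11 (d ∷ rest)

isEven : ℕ → Bool
isEven zero    = true
isEven (suc n) = not (isEven n)

rudinShapiro : {A : Set} → A → A → ℕ → A
rudinShapiro a b n = if isEven (count11 (binary n)) then a else b

UltimatelyPeriodic : {A : Set} → (ℕ → A) → Set
UltimatelyPeriodic ω = ∃[ p ] ∃[ N ] (0 < p × (∀ n → N ≤ n → ω (n + p) ≡ ω n))

IsPrefix : {A : Set} → List A → (ℕ → A) → Set
IsPrefix w ω = (i : Fin (length w)) → lookup w i ≡ ω (toℕ i)

-- Property ♠ with (natural-number) constant c.
-- The ratio bounds |V_n|/|U_n| ≤ c, |W_n|/|U_n| ≤ c are read as |U_n| > 0 together with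
-- |V_n| ≤ c·|U_n| and |W_n| ≤ c·|U_n|.
Spade : {A : Set} → ℕ → (ℕ → A) → Set
Spade {A} c ω =
  ¬ UltimatelyPeriodic ω ×
  Σ (ℕ → List A) λ U → Σ (ℕ → List A) λ V → Σ (ℕ → List A) λ W →
    (∀ n → 1 ≤ n → IsPrefix (W n ++ U n ++ V n ++ U n) ω) ×
    (∀ n → 1 ≤ n → 0 < length (U n) × length (V n) ≤ c * length (U n) × length (W n) ≤ c * length (U n)) ×
    (∀ M → ∃[ n ] (1 ≤ n × M < length (U n)))

{-# OPTIONS --safe #-}
module Submission where

-- Let e(n) = blocks11 n.  If t < 2^k, the binary expansion of 2^(k+1)·m + t is that of t padded
-- to k digits, then a 0, then that of m, so e(2^(k+1)·m + t) = e(t) + e(m).  With m = 1 the first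
-- 2^n letters reappear at position 2^(n+1), so U = w[0, 2^n), V = w[2^n, 2^(n+1)) and W empty
-- work.  If the word had period p from N on, put s = 2^p − p: position 2^(p+1)·m + s has
-- e(s) + e(m) blocks, and p further on lies 2^p·(2m + 1), with e(m) blocks for m = 2N but
-- e(m) + 1 for m = 2N + 1, so e(s) would be both even and odd.

open import Defs
open import Data.Bool using (Bool; true; false; if_then_else_)
open import Data.Bool.Properties using (not-injective)
open import Function using (_∘′_)
open import Data.List using (List; []; _∷_; _++_; length; applyUpTo)
open import Data.List.Properties using (length-applyUpTo; lookup-applyUpTo)
open import Data.Nat using (ℕ; zero; suc; _+_; _*_; _∸_; _^_; _≤_; _<_; _≡ᵇ_; z≤n; s≤s)
open import Data.Nat.DivMod using (_/_; _%_; m*n%n≡0; m*n/n≡m; [m+kn]%n≡m%n; +-distrib-/; m/n<m)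
open import Data.Nat.Properties
open import Data.Nat.Tactic.RingSolver using (solve-∀)
open import Data.Product using (_×_; _,_; ∃-syntax)
open import Relation.Binary.PropositionalEquality
  using (_≡_; _≢_; refl; sym; trans; cong; cong₂; subst; module ≡-Reasoning)
open import Relation.Nullary using (¬_; contradiction)

open ≡-Reasoning

n<2^n : ∀ n → n < 2 ^ n
n<2^n zero    = s≤s z≤n
n<2^n (suc n) = subst (suc n <_) (cong (2 ^ n +_) (sym (+-identityʳ (2 ^ n))))
                      (+-mono-≤-< (m^n>0 2 n) (n<2^n n))

data Parity : ℕ → Set where
  even : ∀ n → Parity (n * 2)
  odd  : ∀ n → Parity (suc (n * 2))

parity : ∀ n → Parity n
parity zero = even 0
parity (suc n) with parity n
... | even m = odd m
... | odd m  = even (suc m)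

bitsAux-fuel : ∀ {k k′ m} → m ≤ k → m ≤ k′ → bitsAux k m ≡ bitsAux k′ m
bitsAux-fuel {zero}  {zero}   {zero}  _       _       = refl
bitsAux-fuel {zero}  {suc _}  {zero}  _       _       = refl
bitsAux-fuel {suc _} {zero}   {zero}  _       _       = refl
bitsAux-fuel {suc _} {suc _}  {zero}  _       _       = refl
bitsAux-fuel {suc k} {suc k′} {suc m} (s≤s p) (s≤s q) =
  cong (_ ∷_) (bitsAux-fuel (≤-trans half≤m p) (≤-trans half≤m q))
  where
  half≤m : suc m / 2 ≤ m
  half≤m = ≤-pred (m/n<m (suc m) 2 (s≤s (s≤s z≤n)))

binary-even : ∀ n → binary (suc n * 2) ≡ false ∷ binary (suc n)
binary-even n = cong₂ _∷_ (cong (_≡ᵇ 1) (m*n%n≡0 (suc n) 2))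
  (trans (cong (bitsAux (suc (n * 2))) (m*n/n≡m (suc n) 2))
         (bitsAux-fuel (s≤s (m≤m*n n 2)) ≤-refl))

binary-odd : ∀ n → binary (suc (n * 2)) ≡ true ∷ binary n
binary-odd n = cong₂ _∷_ (cong (_≡ᵇ 1) ([m+kn]%n≡m%n 1 n 2))
  (trans (cong (bitsAux (n * 2)) half) (bitsAux-fuel (m≤m*n n 2) ≤-refl))
  where
  half : suc (n * 2) / 2 ≡ n
  half = trans (+-distrib-/ 1 (n * 2) (subst (λ r → 1 + r < 2) (sym (m*n%n≡0 n 2)) ≤-refl))
               (m*n/n≡m n 2)

bit : Bool → ℕ
bit true  = 1
bit false = 0

blocks11 : ℕ → ℕ
blocks11 n = count11 (binary n)

-- The bit b below the least significant digit is what makes the concatenation lemma inductive.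
blocks11ᵇ : Bool → ℕ → ℕ
blocks11ᵇ b n = count11 (b ∷ binary n)

blocks11ᵇ-false : ∀ n → blocks11ᵇ false n ≡ blocks11 n
blocks11ᵇ-false zero    = refl
blocks11ᵇ-false (suc n) = refl

blocks11ᵇ-even : ∀ b n → blocks11ᵇ b (n * 2) ≡ blocks11 n
blocks11ᵇ-even b     zero    = refl
blocks11ᵇ-even true  (suc n) = cong (count11 ∘′ (true ∷_)) (binary-even n)
blocks11ᵇ-even false (suc n) = cong (count11 ∘′ (false ∷_)) (binary-even n)

blocks11ᵇ-odd : ∀ b n → blocks11ᵇ b (suc (n * 2)) ≡ bit b + blocks11ᵇ true n
blocks11ᵇ-odd true  n rewrite binary-odd n = refl
blocks11ᵇ-odd false n rewrite binary-odd n = refl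

blocks11-even : ∀ n → blocks11 (n * 2) ≡ blocks11 n
blocks11-even n = trans (sym (blocks11ᵇ-false (n * 2))) (blocks11ᵇ-even false n)

blocks11-odd : ∀ n → blocks11 (suc (n * 2)) ≡ blocks11ᵇ true n
blocks11-odd n = trans (sym (blocks11ᵇ-false (suc (n * 2)))) (blocks11ᵇ-odd false n)

blocks11-2^* : ∀ k n → blocks11 (2 ^ k * n) ≡ blocks11 n
blocks11-2^* zero    n = cong blocks11 (+-identityʳ n)
blocks11-2^* (suc k) n = begin
  blocks11 (2 ^ suc k * n)    ≡⟨ cong blocks11 (double-rotate (2 ^ k) n) ⟩
  blocks11 (2 ^ k * n * 2)    ≡⟨ blocks11-even (2 ^ k * n) ⟩
  blocks11 (2 ^ k * n)        ≡⟨ blocks11-2^* k n ⟩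
  blocks11 n                  ∎
  where
  double-rotate : ∀ x n → 2 * x * n ≡ x * n * 2
  double-rotate = solve-∀

halve-< : ∀ {s} k → s * 2 < 2 ^ suc k → s < 2 ^ k
halve-< {s} k p = *-cancelʳ-< 2 s (2 ^ k) (subst (s * 2 <_) (*-comm 2 (2 ^ k)) p)

blocks11ᵇ-concat : ∀ k t → t < 2 ^ k → ∀ b m →
                   blocks11ᵇ b (2 ^ suc k * m + t) ≡ blocks11ᵇ b t + blocks11 m
blocks11ᵇ-concat zero zero _ b m = trans (cong (blocks11ᵇ b) (double-right m)) (blocks11ᵇ-even b m)
  where
  double-right : ∀ m → 2 * 1 * m + 0 ≡ m * 2
  double-right = solve-∀
blocks11ᵇ-concat zero (suc t) (s≤s ()) b m
blocks11ᵇ-concat (suc k) t t<2^k b m with parity t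
... | even s = begin
  blocks11ᵇ b (2 ^ suc (suc k) * m + s * 2)  ≡⟨ cong (blocks11ᵇ b) (shift-even (2 ^ k) m s) ⟩
  blocks11ᵇ b ((2 ^ suc k * m + s) * 2)      ≡⟨ blocks11ᵇ-even b (2 ^ suc k * m + s) ⟩
  blocks11 (2 ^ suc k * m + s)               ≡⟨ blocks11ᵇ-false (2 ^ suc k * m + s) ⟨
  blocks11ᵇ false (2 ^ suc k * m + s)        ≡⟨ blocks11ᵇ-concat k s (halve-< k t<2^k) false m ⟩
  blocks11ᵇ false s + blocks11 m             ≡⟨ cong (_+ blocks11 m) (blocks11ᵇ-false s) ⟩
  blocks11 s + blocks11 m                    ≡⟨ cong (_+ blocks11 m) (blocks11ᵇ-even b s) ⟨
  blocks11ᵇ b (s * 2) + blocks11 m           ∎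
  where
  shift-even : ∀ x m s → 2 * (2 * x) * m + s * 2 ≡ (2 * x * m + s) * 2
  shift-even = solve-∀
... | odd s = begin
  blocks11ᵇ b (2 ^ suc (suc k) * m + suc (s * 2))  ≡⟨ cong (blocks11ᵇ b) (shift-odd (2 ^ k) m s) ⟩
  blocks11ᵇ b (suc ((2 ^ suc k * m + s) * 2))      ≡⟨ blocks11ᵇ-odd b (2 ^ suc k * m + s) ⟩
  bit b + blocks11ᵇ true (2 ^ suc k * m + s)       ≡⟨ cong (bit b +_) (blocks11ᵇ-concat k s s<2^k true m) ⟩
  bit b + (blocks11ᵇ true s + blocks11 m)          ≡⟨ +-assoc (bit b) _ _ ⟨
  bit b + blocks11ᵇ true s + blocks11 m            ≡⟨ cong (_+ blocks11 m) (blocks11ᵇ-odd b s) ⟨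
  blocks11ᵇ b (suc (s * 2)) + blocks11 m           ∎
  where
  shift-odd : ∀ x m s → 2 * (2 * x) * m + suc (s * 2) ≡ suc ((2 * x * m + s) * 2)
  shift-odd = solve-∀
  s<2^k : s < 2 ^ k
  s<2^k = halve-< k (≤-trans (n≤1+n _) t<2^k)

blocks11-concat : ∀ k t → t < 2 ^ k → ∀ m → blocks11 (2 ^ suc k * m + t) ≡ blocks11 t + blocks11 m
blocks11-concat k t t<2^k m = begin
  blocks11 (2 ^ suc k * m + t)         ≡⟨ blocks11ᵇ-false (2 ^ suc k * m + t) ⟨
  blocks11ᵇ false (2 ^ suc k * m + t)  ≡⟨ blocks11ᵇ-concat k t t<2^k false m ⟩
  blocks11ᵇ false t + blocks11 m       ≡⟨ cong (_+ blocks11 m) (blocks11ᵇ-false t) ⟩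
  blocks11 t + blocks11 m              ∎

isEven-+-cancelʳ : ∀ m n o → isEven (m + o) ≡ isEven (n + o) → isEven m ≡ isEven n
isEven-+-cancelʳ m n zero    e rewrite +-identityʳ m | +-identityʳ n = e
isEven-+-cancelʳ m n (suc o) e rewrite +-suc m o | +-suc n o = isEven-+-cancelʳ m n o (not-injective e)

if-injective : {A : Set} {a b : A} → a ≢ b →
               ∀ x y → (if x then a else b) ≡ (if y then a else b) → x ≡ y
if-injective a≢b true  true  _ = refl
if-injective a≢b false false _ = refl
if-injective a≢b true  false e = contradiction e a≢b
if-injective a≢b false true  e = contradiction (sym e) a≢b

rudinShapiro-repeat : {A : Set} (a b : A) → ∀ n j → j < 2 ^ n →
                      rudinShapiro a b (2 ^ n + (2 ^ n + j)) ≡ rudinShapiro a b j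
rudinShapiro-repeat a b n j j<2^n = cong (λ e → if isEven e then a else b) (begin
  blocks11 (2 ^ n + (2 ^ n + j))  ≡⟨ cong blocks11 (two-copies (2 ^ n) j) ⟩
  blocks11 (2 ^ suc n * 1 + j)    ≡⟨ blocks11-concat n j j<2^n 1 ⟩
  blocks11 j + 0                  ≡⟨ +-identityʳ (blocks11 j) ⟩
  blocks11 j                      ∎)
  where
  two-copies : ∀ x j → x + (x + j) ≡ 2 * x * 1 + j
  two-copies = solve-∀

rudinShapiro-aperiodic : {A : Set} {a b : A} → a ≢ b → ¬ UltimatelyPeriodic (rudinShapiro a b)
rudinShapiro-aperiodic a≢b (zero , _ , () , _)
rudinShapiro-aperiodic a≢b (p@(suc _) , N , _ , periodic) =
  contradiction (trans (sym s-even) s-odd) λ ()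
  where
  s : ℕ
  s = 2 ^ p ∸ p

  p≤2^p : p ≤ 2 ^ p
  p≤2^p = <⇒≤ (n<2^n p)

  s<2^p : s < 2 ^ p
  s<2^p = ∸-monoʳ-< {2 ^ p} {p} {0} (s≤s z≤n) p≤2^p

  position : ℕ → ℕ
  position m = 2 ^ suc p * m + s

  position+p : ∀ m → position m + p ≡ 2 ^ p * suc (m * 2)
  position+p m = begin
    2 ^ suc p * m + s + p      ≡⟨ +-assoc (2 ^ suc p * m) s p ⟩
    2 ^ suc p * m + (s + p)    ≡⟨ cong (2 ^ suc p * m +_) (m∸n+n≡m p≤2^p) ⟩
    2 ^ suc p * m + 2 ^ p      ≡⟨ factor (2 ^ p) m ⟩
    2 ^ p * suc (m * 2)        ∎
    where
    factor : ∀ x m → 2 * x * m + x ≡ x * suc (m * 2)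
    factor = solve-∀

  N≤position : ∀ m → N ≤ m → N ≤ position m
  N≤position m N≤m =
    ≤-trans N≤m (≤-trans (m≤n*m m (2 ^ suc p) {{m^n≢0 2 (suc p)}}) (m≤m+n (2 ^ suc p * m) s))

  jump : ∀ m → N ≤ m → isEven (blocks11 s + blocks11 m) ≡ isEven (blocks11ᵇ true m)
  jump m N≤m = begin
    isEven (blocks11 s + blocks11 m)         ≡⟨ cong isEven (blocks11-concat p s s<2^p m) ⟨
    isEven (blocks11 (position m))           ≡⟨ if-injective a≢b _ _ (periodic (position m) (N≤position m N≤m)) ⟨
    isEven (blocks11 (position m + p))       ≡⟨ cong (isEven ∘′ blocks11) (position+p m) ⟩
    isEven (blocks11 (2 ^ p * suc (m * 2)))  ≡⟨ cong isEven (blocks11-2^* p (suc (m * 2))) ⟩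
    isEven (blocks11 (suc (m * 2)))          ≡⟨ cong isEven (blocks11-odd m) ⟩
    isEven (blocks11ᵇ true m)                ∎

  s-even : isEven (blocks11 s) ≡ isEven 0
  s-even = isEven-+-cancelʳ (blocks11 s) 0 (blocks11 N) (begin
    isEven (blocks11 s + blocks11 N)        ≡⟨ cong (λ c → isEven (blocks11 s + c)) (blocks11-even N) ⟨
    isEven (blocks11 s + blocks11 (N * 2))  ≡⟨ jump (N * 2) (m≤m*n N 2) ⟩
    isEven (blocks11ᵇ true (N * 2))         ≡⟨ cong isEven (blocks11ᵇ-even true N) ⟩
    isEven (blocks11 N)                     ∎)

  s-odd : isEven (blocks11 s) ≡ isEven 1
  s-odd = isEven-+-cancelʳ (blocks11 s) 1 (blocks11ᵇ true N) (begin
    isEven (blocks11 s + blocks11ᵇ true N)        ≡⟨ cong (λ c → isEven (blocks11 s + c)) (blocks11-odd N) ⟨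
    isEven (blocks11 s + blocks11 (suc (N * 2)))  ≡⟨ jump (suc (N * 2)) (≤-trans (m≤m*n N 2) (n≤1+n _)) ⟩
    isEven (blocks11ᵇ true (suc (N * 2)))         ≡⟨ cong isEven (blocks11ᵇ-odd true N) ⟩
    isEven (1 + blocks11ᵇ true N)                 ∎)

applyUpTo-++ : {A : Set} (f : ℕ → A) → ∀ m n →
               applyUpTo f (m + n) ≡ applyUpTo f m ++ applyUpTo (λ i → f (m + i)) n
applyUpTo-++ f zero    n = refl
applyUpTo-++ f (suc m) n = cong (f 0 ∷_) (applyUpTo-++ (f ∘′ suc) m n)

applyUpTo-cong : {A : Set} {f g : ℕ → A} → ∀ n → (∀ i → i < n → f i ≡ g i) →
                 applyUpTo f n ≡ applyUpTo g n
applyUpTo-cong zero    _   = refl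
applyUpTo-cong (suc n) f≗g = cong₂ _∷_ (f≗g 0 (s≤s z≤n)) (applyUpTo-cong n (λ i i<n → f≗g (suc i) (s≤s i<n)))

isPrefix-repeat : {A : Set} (ω : ℕ → A) → ∀ L → (∀ j → j < L → ω (L + (L + j)) ≡ ω j) →
                  IsPrefix (applyUpTo ω L ++ applyUpTo (λ i → ω (L + i)) L ++ applyUpTo ω L) ω
isPrefix-repeat ω L repeat = subst (λ w → IsPrefix w ω) split (lookup-applyUpTo ω (L + (L + L)))
  where
  split : applyUpTo ω (L + (L + L)) ≡ applyUpTo ω L ++ applyUpTo (λ i → ω (L + i)) L ++ applyUpTo ω L
  split = begin
    applyUpTo ω (L + (L + L))
      ≡⟨ applyUpTo-++ ω L (L + L) ⟩
    applyUpTo ω L ++ applyUpTo (λ i → ω (L + i)) (L + L)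
      ≡⟨ cong (applyUpTo ω L ++_) (applyUpTo-++ (λ i → ω (L + i)) L L) ⟩
    applyUpTo ω L ++ applyUpTo (λ i → ω (L + i)) L ++ applyUpTo (λ i → ω (L + (L + i))) L
      ≡⟨ cong (λ u → applyUpTo ω L ++ applyUpTo (λ i → ω (L + i)) L ++ u) (applyUpTo-cong L repeat) ⟩
    applyUpTo ω L ++ applyUpTo (λ i → ω (L + i)) L ++ applyUpTo ω L
      ∎

proposition2p4 : {A : Set} (a b : A) → a ≢ b → Spade 25 (rudinShapiro a b)
proposition2p4 {A} a b a≢b = rudinShapiro-aperiodic a≢b , U , V , W , prefix , bounds , unbounded
  where
  ω : ℕ → A
  ω = rudinShapiro a b

  U V W : ℕ → List A
  U n = applyUpTo ω (2 ^ n)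
  V n = applyUpTo (λ i → ω (2 ^ n + i)) (2 ^ n)
  W _ = []

  |U| : ∀ n → length (U n) ≡ 2 ^ n
  |U| n = length-applyUpTo ω (2 ^ n)

  prefix : ∀ n → 1 ≤ n → IsPrefix (W n ++ U n ++ V n ++ U n) ω
  prefix n _ = isPrefix-repeat ω (2 ^ n) (rudinShapiro-repeat a b n)

  bounds : ∀ n → 1 ≤ n → 0 < length (U n) × length (V n) ≤ 25 * length (U n) × length (W n) ≤ 25 * length (U n)
  bounds n _ rewrite |U| n | length-applyUpTo (λ i → ω (2 ^ n + i)) (2 ^ n) =
    m^n>0 2 n , m≤n*m (2 ^ n) 25 , z≤n

  unbounded : ∀ M → ∃[ n ] (1 ≤ n × M < length (U n))
  unbounded M = suc M , s≤s z≤n , subst (M <_) (sym (|U| (suc M))) (<-trans (n<1+n M) (n<2^n (suc M)))
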